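{- Let $\Gamma$, $\Gamma_1$, $\Gamma_2$ be marked $n$-trees. (1) If there are contractions $\Gamma_1\to\Gamma$ and $\Gamma_2\to\Gamma$, then there is a contraction $\Gamma_1\to\Gamma_2$ if and only if $F(\Gamma_2,\Gamma)$ is a subforest of $F(\Gamma_1,\Gamma)$. (2) If there are contractions $\Gamma\to\Gamma_1$ and $\Gamma\to\Gamma_2$, then there is a contraction $\Gamma_1\to\Gamma_2$ if and only if $F(\Gamma,\Gamma_1)$ is a subforest of $F(\Gamma,\Gamma_2)$.
   Context: A tree is a finite, contractible, $1$-dimensional simplicial complex; connected subcomplexes are subtrees, and a collection of disjoint subtrees is a subforest. For $n\ge 3$, a marked $n$-tree is a tree with distinct marked vertices $v_1,\dots,v_n$ such that every vertex of valence $1$ or $2$ is marked. A contraction $f\colon\Gamma_1\to\Gamma_2$ of $n$-trees is a surjective cellular map (up to isotopy within edges) with $f^{ -1}(v_i)$ a subtree of $\Gamma_1$ containing $v_i$ for each $i$. Equivalently, a contraction collapses to points the components of a subforest whose components each contain at most one marked vertex. Such a contraction, when it exists, is unique. A subtree is unmarked if it contains no marked vertex and singly-marked if it contains exactly one. If $\Gamma_1\to\Gamma_2$ is a contraction, $F(\Gamma_1,\Gamma_2)$ denotes the unique subforest of $\Gamma_1$ with the following two properties: all its components are unmarked or singly-marked subtrees, and contracting them yields $\Gamma_2$. -}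

module Defs where

open import Data.Nat using (ℕ; _+_)
open import Data.Fin using (Fin; _≟_)
open import Data.Bool using (Bool; true; false)
open import Data.List using (List; length; filter; allFin)
open import Data.Product using (Σ; ∃; _×_)
open import Data.Sum using (_⊎_)
open import Data.Unit using (⊤)
open import Relation.Nullary using (¬_)
open import Relation.Binary.PropositionalEquality using (_≡_; _≢_)
open import Function.Bundles using (_⇔_)
open import Function.Definitions using (Injective; Bijective)

record Graph : Set where
  field
    V E : ℕ
    src tgt : Fin E → Fin V

data Path (G : Graph) (A : Fin (Graph.E G) → Set) : Fin (Graph.V G) → Fin (Graph.V G) → Set where
  here : ∀ {v} → Path G A v v
  fwd  : ∀ {w} (e : Fin (Graph.E G)) → A e → Path G A (Graph.tgt G e) w → Path G A (Graph.src G e) w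
  bwd  : ∀ {w} (e : Fin (Graph.E G)) → A e → Path G A (Graph.src G e) w → Path G A (Graph.tgt G e) w

AllEdges : (G : Graph) → Fin (Graph.E G) → Set
AllEdges G _ = ⊤

-- Valence of a vertex (a loop would count twice; trees have no loops).
valence : (G : Graph) → Fin (Graph.V G) → ℕ
valence G v = length (filter (λ e → src e ≟ v) (allFin E))
            + length (filter (λ e → tgt e ≟ v) (allFin E))
  where open Graph G

-- A tree (finite contractible 1-dim simplicial complex): connected, and
-- acyclic, expressed as "every edge is a bridge" (this also rules out
-- loops and multiple edges, so the graph is a simplicial complex).
record Tree : Set where
  field
    graph     : Graph
  open Graph graph public
  field
    connected : ∀ u v → Path graph (AllEdges graph) u v
    acyclic   : ∀ e → ¬ Path graph (λ e' → e' ≢ e) (src e) (tgt e)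

record MTree (n : ℕ) : Set where
  field
    tree   : Tree
  open Tree tree public
  field
    mark        : Fin n → Fin V
    mark-inj    : Injective _≡_ _≡_ mark
    low-marked  : ∀ v → (valence graph v ≡ 1 ⊎ valence graph v ≡ 2) → ∃ λ i → mark i ≡ v

In : ∀ {k} → (Fin k → Bool) → Fin k → Set
In C e = C e ≡ true

-- A contraction Γ₁ → Γ₂: collapse the subforest spanned by the edge set
-- `collapsed` (each of whose components contains at most one marked vertex);
-- the quotient tree is identified with Γ₂ via a vertex map φ (whose fibres are
-- exactly the components) and a bijection ψ from the remaining edges to the
-- edges of Γ₂, compatible with endpoints and markings.
record Contraction {n : ℕ} (Γ₁ Γ₂ : MTree n) : Set where
  private
    module A = MTree Γ₁
    module B = MTree Γ₂
  field
    collapsed : Fin A.E → Bool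
    singly    : ∀ i j → Path A.graph (In collapsed) (A.mark i) (A.mark j) → i ≡ j
    φ         : Fin A.V → Fin B.V
    φ-surj    : ∀ w → ∃ λ v → φ v ≡ w
    φ-fibres  : ∀ u v → (φ u ≡ φ v) ⇔ Path A.graph (In collapsed) u v
    φ-mark    : ∀ i → φ (A.mark i) ≡ B.mark i
    ψ         : Σ (Fin A.E) (λ e → collapsed e ≡ false) → Fin B.E
    ψ-bij     : Bijective _≡_ _≡_ ψ
    ψ-ends    : ∀ (p : Σ (Fin A.E) (λ e → collapsed e ≡ false)) →
                  let e = Data.Product.proj₁ p in
                  (B.src (ψ p) ≡ φ (A.src e) × B.tgt (ψ p) ≡ φ (A.tgt e))
                ⊎ (B.src (ψ p) ≡ φ (A.tgt e) × B.tgt (ψ p) ≡ φ (A.src e))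

F : ∀ {n} {Γ₁ Γ₂ : MTree n} → Contraction Γ₁ Γ₂ → Fin (MTree.E Γ₁) → Bool
F c = Contraction.collapsed c

SameSide : ∀ {n} (Γ : MTree n) → Fin (MTree.E Γ) → Fin n → Fin n → Set
SameSide Γ e i j = Path (MTree.graph Γ) (λ e' → e' ≢ e) (MTree.mark Γ i) (MTree.mark Γ j)

-- Edges of two marked n-trees are identified when they induce the same
-- split of the marked vertices.
SameEdge : ∀ {n} (Γ : MTree n) → Fin (MTree.E Γ) → (Γ' : MTree n) → Fin (MTree.E Γ') → Set
SameEdge Γ e Γ' e' = ∀ i j → SameSide Γ e i j ⇔ SameSide Γ' e' i j

SubforestOf : ∀ {n} (Γ : MTree n) → (Fin (MTree.E Γ) → Bool) →
              (Γ' : MTree n) → (Fin (MTree.E Γ') → Bool) → Set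
SubforestOf Γ S Γ' S' = ∀ e → S e ≡ true → ∃ λ e' → S' e' ≡ true × SameEdge Γ e Γ' e'

module Submission where

-- An edge of a marked tree is determined by the split it induces on the marked vertices, and a contraction
-- Γ₁ → Γ₂ exists exactly when every split of Γ₂ is a split of Γ₁.  Given such a refinement, collapse the
-- edges of Γ₁ whose splits do not occur in Γ₂, and send a vertex x of Γ₁ to the vertex of Γ₂ lying, for
-- every edge, on the side matching the side of x; that vertex exists by a Helly property for the halves
-- of a tree, pairwise consistency coming from marked vertices (every region cut out by two edges contains
-- one, as its extremal vertices have valence at most two).  Consequently the edges a contraction collapses
-- are exactly those whose splits disappear, and both parts of the corollary become inclusions of split sets.

open import Defs
open import Data.Nat using (ℕ; zero; suc; _≤_; _+_; z≤n; s≤s)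
open import Data.Nat.Properties
  using (≤-trans; ≤-reflexive; +-suc; m≤m+n; m≤n+m; m≤n⇒m≤1+n; suc-injective; n≮n; 0≢1+n; module ≤-Reasoning)
open import Data.Fin using (Fin; _≟_) renaming (zero to fzero; suc to fsuc)
open import Data.Fin.Properties using (any?) renaming (suc-injective to fsuc-injective)
open import Data.Bool using (Bool; true; false; not; _xor_; _∧_; _∨_; if_then_else_)
open import Data.Bool.Properties
  using (¬-not; not-¬; xor-same; xor-assoc; xor-identityʳ) renaming (_≟_ to _≟ᵇ_)
open import Data.Product using (Σ; ∃; _×_; _,_; proj₁; proj₂)
open import Data.Sum using (_⊎_; inj₁; inj₂; [_,_]′; swap) renaming (map to ⊎-map)
open import Data.Empty using (⊥; ⊥-elim)
open import Data.List using (length; filter; tabulate)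
open import Relation.Nullary using (Dec; yes; no; does; ¬?)
open import Relation.Nullary.Decidable using (_×-dec_; _⊎-dec_; decidable-stable; dec-true)
open import Relation.Unary using (Decidable)
open import Relation.Binary.PropositionalEquality
open import Function using (_∘_; const)
open import Function.Bundles using (_⇔_; mk⇔; Equivalence)
open import Function.Definitions using (Bijective)
open import Function.Properties.Equivalence using () renaming (sym to ⇔-sym; trans to ⇔-trans)
open import Axiom.UniquenessOfIdentityProofs using (module Decidable⇒UIP)

module _ {G : Graph} where
  open Graph G

  infixr 5 _++ₚ_

  _++ₚ_ : ∀ {A : Fin E → Set} {u v w} → Path G A u v → Path G A v w → Path G A u w
  here      ++ₚ q = q
  fwd e a p ++ₚ q = fwd e a (p ++ₚ q)
  bwd e a p ++ₚ q = bwd e a (p ++ₚ q)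

  reverseₚ : ∀ {A : Fin E → Set} {u v} → Path G A u v → Path G A v u
  reverseₚ here        = here
  reverseₚ (fwd e a p) = reverseₚ p ++ₚ bwd e a here
  reverseₚ (bwd e a p) = reverseₚ p ++ₚ fwd e a here

  mapₚ : ∀ {A B : Fin E → Set} {u v} → (∀ {e} → A e → B e) → Path G A u v → Path G B u v
  mapₚ f here        = here
  mapₚ f (fwd e a p) = fwd e (f a) (mapₚ f p)
  mapₚ f (bwd e a p) = bwd e (f a) (mapₚ f p)

true≢false : true ≢ false
true≢false ()

xor-≢ : ∀ {a b} → a ≢ b → a xor b ≡ true
xor-≢ {true}  {true}  a≢b = ⊥-elim (a≢b refl)
xor-≢ {true}  {false} _   = refl
xor-≢ {false} {true}  _   = refl
xor-≢ {false} {false} a≢b = ⊥-elim (a≢b refl)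

xor-cancelʳ : ∀ a t → (a xor t) xor t ≡ a
xor-cancelʳ a t = begin
  (a xor t) xor t  ≡⟨ xor-assoc a t t ⟩
  a xor (t xor t)  ≡⟨ cong (a xor_) (xor-same t) ⟩
  a xor false      ≡⟨ xor-identityʳ a ⟩
  a                ∎
  where open ≡-Reasoning

xor-injectiveʳ : ∀ {a b} t → a xor t ≡ b xor t → a ≡ b
xor-injectiveʳ {a} {b} t eq = trans (sym (xor-cancelʳ a t)) (trans (cong (_xor t) eq) (xor-cancelʳ b t))

≡⇔≡⇒xor≡ : ∀ {a b c d} → (a ≡ b → c ≡ d) → (c ≡ d → a ≡ b) → a xor b ≡ c xor d
≡⇔≡⇒xor≡ {a} {b} {c} {d} f g with a ≟ᵇ b | c ≟ᵇ d
... | yes refl | yes refl = trans (xor-same a) (sym (xor-same c))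
... | yes a≡b  | no c≢d   = ⊥-elim (c≢d (f a≡b))
... | no a≢b   | yes c≡d  = ⊥-elim (a≢b (g c≡d))
... | no a≢b   | no c≢d   = trans (xor-≢ a≢b) (sym (xor-≢ c≢d))

count : ∀ {k} → (Fin k → Bool) → ℕ
count {zero}  f = 0
count {suc k} f = (if f fzero then 1 else 0) + count (f ∘ fsuc)

count-cong : ∀ {k} {f g : Fin k → Bool} → (∀ i → f i ≡ g i) → count f ≡ count g
count-cong {zero}  f≗g = refl
count-cong {suc k} f≗g = cong₂ _+_ (cong (λ b → if b then 1 else 0) (f≗g fzero)) (count-cong (f≗g ∘ fsuc))

count≤ : ∀ {k} (f : Fin k → Bool) → count f ≤ k
count≤ {zero}  f = z≤n
count≤ {suc k} f with f fzero
... | true  = s≤s (count≤ (f ∘ fsuc))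
... | false = m≤n⇒m≤1+n (count≤ (f ∘ fsuc))

count-pos : ∀ {k} {f : Fin k → Bool} j → f j ≡ true → 1 ≤ count f
count-pos {f = f} fzero    fj rewrite fj = s≤s z≤n
count-pos {f = f} (fsuc j) fj = ≤-trans (count-pos j fj) (m≤n+m _ (if f fzero then 1 else 0))

count-insert : ∀ {k} {f g : Fin k → Bool} j → f j ≡ false → g j ≡ true →
               (∀ i → i ≢ j → f i ≡ g i) → count g ≡ suc (count f)
count-insert fzero fj gj f≗g rewrite fj | gj = cong suc (count-cong (λ i → sym (f≗g (fsuc i) λ ())))
count-insert {f = f} {g} (fsuc j) fj gj f≗g rewrite f≗g fzero (λ ()) =
  trans (cong ((if g fzero then 1 else 0) +_) (count-insert j fj gj (λ i i≢j → f≗g (fsuc i) (i≢j ∘ fsuc-injective))))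
        (+-suc (if g fzero then 1 else 0) _)

count-mono : ∀ {k} {f g : Fin k → Bool} → (∀ i → f i ≡ true → g i ≡ true) → count f ≤ count g
count-mono {zero}          f⊆g = z≤n
count-mono {suc k} {f} {g} f⊆g with f fzero in f0 | g fzero in g0
... | true  | true  = s≤s (count-mono (f⊆g ∘ fsuc))
... | true  | false = ⊥-elim (true≢false (trans (sym (f⊆g fzero f0)) g0))
... | false | true  = m≤n⇒m≤1+n (count-mono (f⊆g ∘ fsuc))
... | false | false = count-mono (f⊆g ∘ fsuc)

count-∨-disjoint : ∀ {k} (f g : Fin k → Bool) → (∀ i → f i ∧ g i ≡ false) →
                   count f + count g ≡ count (λ i → f i ∨ g i)
count-∨-disjoint {zero}  f g disj = refl
count-∨-disjoint {suc k} f g disj with f fzero | g fzero | disj fzero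
... | true  | false | _ = cong suc (count-∨-disjoint (f ∘ fsuc) (g ∘ fsuc) (disj ∘ fsuc))
... | false | true  | _ = trans (+-suc _ _) (cong suc (count-∨-disjoint (f ∘ fsuc) (g ∘ fsuc) (disj ∘ fsuc)))
... | false | false | _ = count-∨-disjoint (f ∘ fsuc) (g ∘ fsuc) (disj ∘ fsuc)

count-∨ : ∀ {k} (f g : Fin k → Bool) → count (λ i → f i ∨ g i) ≤ count f + count g
count-∨ {zero}  f g = z≤n
count-∨ {suc k} f g with f fzero | g fzero | count-∨ (f ∘ fsuc) (g ∘ fsuc)
... | true  | true  | ih = s≤s (≤-trans (m≤n⇒m≤1+n ih) (≤-reflexive (sym (+-suc _ _))))
... | true  | false | ih = s≤s ih
... | false | true  | ih = ≤-trans (s≤s ih) (≤-reflexive (sym (+-suc _ _)))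
... | false | false | ih = ih

count-singleton : ∀ {k} (a : Fin k) → count (λ i → does (i ≟ a)) ≡ 1
count-singleton {suc k} fzero    = cong suc (count-successors k)
  where
  count-successors : ∀ k → count {k} (λ i → does (fsuc i ≟ fzero)) ≡ 0
  count-successors zero    = refl
  count-successors (suc k) = count-successors k
count-singleton {suc k} (fsuc a) = count-singleton a

length-filter-tabulate : ∀ {k} {A : Set} {P : A → Set} (P? : Decidable P) (f : Fin k → A) →
                         length (filter P? (tabulate f)) ≡ count (λ i → does (P? (f i)))
length-filter-tabulate {zero}  P? f = refl
length-filter-tabulate {suc k} P? f with does (P? (f fzero))
... | true  = cong suc (length-filter-tabulate P? (f ∘ fsuc))
... | false = length-filter-tabulate P? (f ∘ fsuc)

Incident : (T : Tree) → Fin (Tree.V T) → Fin (Tree.E T) → Set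
Incident T v g = Tree.src T g ≡ v ⊎ Tree.tgt T g ≡ v

module TreeSides (T : Tree) where
  open Tree T

  Avoiding : Fin E → Fin V → Fin V → Set
  Avoiding f = Path graph (λ e → e ≢ f)

  incident? : ∀ v g → Dec (Incident T v g)
  incident? v g = (src g ≟ v) ⊎-dec (tgt g ≟ v)

  toEndpoint : ∀ f {v} → Path graph (AllEdges graph) v (src f) → Avoiding f v (src f) ⊎ Avoiding f v (tgt f)
  toEndpoint f here = inj₁ here
  toEndpoint f (fwd e _ p) with e ≟ f
  ... | yes refl = inj₁ here
  ... | no e≢f   = ⊎-map (fwd e e≢f) (fwd e e≢f) (toEndpoint f p)
  toEndpoint f (bwd e _ p) with e ≟ f
  ... | yes refl = inj₂ here
  ... | no e≢f   = ⊎-map (bwd e e≢f) (bwd e e≢f) (toEndpoint f p)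

  private
    not-both-endpoints : ∀ {f v} → Avoiding f v (src f) → Avoiding f v (tgt f) → ⊥
    not-both-endpoints p q = acyclic _ (reverseₚ p ++ₚ q)

  -- side f v is true iff v lies in the component of src f in T minus f.
  abstract
    side : Fin E → Fin V → Bool
    side f v = [ const true , const false ]′ (toEndpoint f (connected v (src f)))

    side-true : ∀ {f v} → Avoiding f v (src f) → side f v ≡ true
    side-true {f} {v} p with toEndpoint f (connected v (src f))
    ... | inj₁ _ = refl
    ... | inj₂ q = ⊥-elim (not-both-endpoints p q)

    side-false : ∀ {f v} → Avoiding f v (tgt f) → side f v ≡ false
    side-false {f} {v} q with toEndpoint f (connected v (src f))
    ... | inj₁ p = ⊥-elim (not-both-endpoints p q)
    ... | inj₂ _ = refl

    side-spec : ∀ f v → (side f v ≡ true × Avoiding f v (src f)) ⊎ (side f v ≡ false × Avoiding f v (tgt f))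
    side-spec f v with toEndpoint f (connected v (src f))
    ... | inj₁ p = inj₁ (refl , p)
    ... | inj₂ q = inj₂ (refl , q)

  avoiding⇒sameSide : ∀ {f u v} → Avoiding f u v → side f u ≡ side f v
  avoiding⇒sameSide {f} {u} {v} p with side-spec f v
  ... | inj₁ (v-side , q) = trans (side-true (p ++ₚ q)) (sym v-side)
  ... | inj₂ (v-side , q) = trans (side-false (p ++ₚ q)) (sym v-side)

  sameSide⇒avoiding : ∀ {f u v} → side f u ≡ side f v → Avoiding f u v
  sameSide⇒avoiding {f} {u} {v} eq with side-spec f u | side-spec f v
  ... | inj₁ (_ , p) | inj₁ (_ , q) = p ++ₚ reverseₚ q
  ... | inj₂ (_ , p) | inj₂ (_ , q) = p ++ₚ reverseₚ q
  ... | inj₁ (u-side , _) | inj₂ (v-side , _) = ⊥-elim (true≢false (trans (sym u-side) (trans eq v-side)))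
  ... | inj₂ (u-side , _) | inj₁ (v-side , _) = ⊥-elim (true≢false (trans (sym v-side) (trans (sym eq) u-side)))

  side-src : ∀ f → side f (src f) ≡ true
  side-src f = side-true here

  side-tgt : ∀ f → side f (tgt f) ≡ false
  side-tgt f = side-false here

  side-adjacent : ∀ {g f} → g ≢ f → side f (src g) ≡ side f (tgt g)
  side-adjacent g≢f = avoiding⇒sameSide (fwd _ g≢f here)

  side-incident : ∀ {a g h} → g ≢ h → Incident T a g → side h a ≡ side h (src g)
  side-incident g≢h (inj₁ refl) = refl
  side-incident g≢h (inj₂ refl) = sym (side-adjacent g≢h)

  endpoints-by-side : ∀ {u w g} → Incident T u g → Incident T w g → side g u ≡ side g w → u ≡ w
  endpoints-by-side (inj₁ refl) (inj₁ refl) _ = refl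
  endpoints-by-side (inj₂ refl) (inj₂ refl) _ = refl
  endpoints-by-side {g = g} (inj₁ refl) (inj₂ refl) eq =
    ⊥-elim (true≢false (trans (sym (side-src g)) (trans eq (side-tgt g))))
  endpoints-by-side {g = g} (inj₂ refl) (inj₁ refl) eq =
    ⊥-elim (true≢false (trans (sym (side-src g)) (trans (sym eq) (side-tgt g))))

  nearest-endpoint : ∀ g v → ∃ λ a → Incident T a g × Avoiding g v a
  nearest-endpoint g v =
    [ (λ p → src g , inj₁ refl , p) , (λ q → tgt g , inj₂ refl , q) ]′ (toEndpoint g (connected v (src g)))

  endpoint-on : ∀ e b → ∃ λ a → side e a ≡ b
  endpoint-on e true  = src e , side-src e
  endpoint-on e false = tgt e , side-tgt e

  opposite : ∀ {v g} → Incident T v g → Fin V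
  opposite {g = g} (inj₁ _) = tgt g
  opposite {g = g} (inj₂ _) = src g

  crossₚ : ∀ {A : Fin E → Set} {v g} (i : Incident T v g) → A g → Path graph A v (opposite i)
  crossₚ {g = g} (inj₁ refl) a = fwd g a here
  crossₚ {g = g} (inj₂ refl) a = bwd g a here

  side-opposite : ∀ {v g} (i : Incident T v g) → side g (opposite i) ≡ not (side g v)
  side-opposite {g = g} (inj₁ refl) rewrite side-src g | side-tgt g = refl
  side-opposite {g = g} (inj₂ refl) rewrite side-src g | side-tgt g = refl

  side-opposite-≢ : ∀ {v g x} (i : Incident T v g) → side g v ≢ side g x → side g (opposite i) ≡ side g x
  side-opposite-≢ i d = trans (side-opposite i) (sym (¬-not (d ∘ sym)))

  side-opposite-other : ∀ {v g h} (i : Incident T v g) → g ≢ h → side h (opposite i) ≡ side h v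
  side-opposite-other i g≢h = sym (avoiding⇒sameSide (crossₚ i g≢h))

  firstCrossing : ∀ {A : Fin E → Set} g {u v} → Path graph A u v → side g u ≢ side g v →
                  ∃ λ w → Incident T w g × Path graph (λ e → A e × e ≢ g) u w
  firstCrossing g here d = ⊥-elim (d refl)
  firstCrossing g (fwd e a p) d with e ≟ g
  ... | yes refl = src e , inj₁ refl , here
  ... | no e≢g with firstCrossing g p (d ∘ trans (side-adjacent e≢g))
  ...   | w , i , q = w , i , fwd e (a , e≢g) q
  firstCrossing g (bwd e a p) d with e ≟ g
  ... | yes refl = tgt e , inj₂ refl , here
  ... | no e≢g with firstCrossing g p (d ∘ trans (sym (side-adjacent e≢g)))
  ...   | w , i , q = w , i , bwd e (a , e≢g) q

  -- The splits of distinct edges are compatible: the quadrant on the far side of each edge from the other is empty.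
  far-quadrant-empty : ∀ {g h w} → g ≢ h → side g w ≢ side g (src h) → side h w ≢ side h (src g) → ⊥
  far-quadrant-empty {g} {h} {w} g≢h dg dh with nearest-endpoint g w
  ... | a , ia , p with firstCrossing h p (λ eq → dh (trans eq (side-incident g≢h ia)))
  ...   | u , iu , q =
    dg (trans (avoiding⇒sameSide (mapₚ proj₁ q)) (side-incident (g≢h ∘ sym) iu))

  no-four-quadrants : ∀ {g h x y₁ y₂ y₃} → g ≢ h →
    side g y₁ ≢ side g x → side h y₁ ≡ side h x →
    side g y₂ ≡ side g x → side h y₂ ≢ side h x →
    side g y₃ ≢ side g x → side h y₃ ≢ side h x → ⊥
  no-four-quadrants {g} {h} {x} g≢h g₁ h₁ g₂ h₂ g₃ h₃
    with side g x ≟ᵇ side g (src h) | side h x ≟ᵇ side h (src g)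
  ... | yes gx | yes hx = far-quadrant-empty g≢h (λ e → g₃ (trans e (sym gx))) (λ e → h₃ (trans e (sym hx)))
  ... | yes gx | no hx  = far-quadrant-empty g≢h (λ e → g₁ (trans e (sym gx))) (λ e → hx (trans (sym h₁) e))
  ... | no gx  | yes hx = far-quadrant-empty g≢h (λ e → gx (trans (sym g₂) e)) (λ e → h₂ (trans e (sym hx)))
  ... | no gx  | no hx  = far-quadrant-empty g≢h gx hx

  towards : ∀ {x y} → Path graph (AllEdges graph) x y → x ≢ y → ∃ λ g → Incident T y g × side g y ≢ side g x
  towards here x≢y = ⊥-elim (x≢y refl)
  towards {y = y} (fwd e _ p) x≢y with tgt e ≟ y
  ... | yes refl = e , inj₂ refl , λ eq → true≢false (trans (sym (side-src e)) (trans (sym eq) (side-tgt e)))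
  ... | no t≢y with towards p t≢y
  ...   | g , i , d with g ≟ e
  ...     | no g≢e = g , i , λ eq → d (trans eq (side-adjacent (g≢e ∘ sym)))
  ...     | yes refl = ⊥-elim ([ x≢y , t≢y ]′ i)
  towards {y = y} (bwd e _ p) x≢y with src e ≟ y
  ... | yes refl = e , inj₁ refl , λ eq → true≢false (trans (sym (side-src e)) (trans eq (side-tgt e)))
  ... | no s≢y with towards p s≢y
  ...   | g , i , d with g ≟ e
  ...     | no g≢e = g , i , λ eq → d (trans eq (sym (side-adjacent (g≢e ∘ sym))))
  ...     | yes refl = ⊥-elim ([ s≢y , x≢y ]′ i)

  next : ∀ {x y} → x ≢ y → ∃ λ g → Incident T x g × side g x ≢ side g y
  next x≢y = towards (connected _ _) (x≢y ∘ sym)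

  sides-determine-vertex : ∀ {x y} → (∀ h → side h x ≡ side h y) → x ≡ y
  sides-determine-vertex {x} {y} same with x ≟ y
  ... | yes x≡y = x≡y
  ... | no x≢y  = let (g , _ , d) = next x≢y in ⊥-elim (d (same g))

  only-separator⇒endpoints : ∀ {x y e} → (∀ h → h ≢ e → side h x ≡ side h y) → side e x ≢ side e y →
                             (src e ≡ x × tgt e ≡ y) ⊎ (src e ≡ y × tgt e ≡ x)
  only-separator⇒endpoints {x} {y} {e} same d =
    endpoints (incident same d) (incident (λ h h≢e → sym (same h h≢e)) (d ∘ sym))
    where
    incident : ∀ {u w} → (∀ h → h ≢ e → side h u ≡ side h w) → side e u ≢ side e w → Incident T u e
    incident {u} {w} same' d' with u ≟ w
    ... | yes refl = ⊥-elim (d' refl)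
    ... | no u≢w with next u≢w
    ...   | g , i , dg with g ≟ e
    ...     | yes refl = i
    ...     | no g≢e   = ⊥-elim (dg (same' g g≢e))
    endpoints : Incident T x e → Incident T y e → (src e ≡ x × tgt e ≡ y) ⊎ (src e ≡ y × tgt e ≡ x)
    endpoints (inj₁ s)    (inj₂ t)    = inj₁ (s , t)
    endpoints (inj₂ t)    (inj₁ s)    = inj₂ (s , t)
    endpoints (inj₁ refl) (inj₁ refl) = ⊥-elim (d refl)
    endpoints (inj₂ refl) (inj₂ refl) = ⊥-elim (d refl)

  dist : Fin V → Fin V → ℕ
  dist x y = count (λ h → side h x xor side h y)

  dist-toward : ∀ {v g x} (i : Incident T v g) → side g v ≢ side g x → dist v x ≡ suc (dist (opposite i) x)
  dist-toward {v} {g} {x} i d =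
    count-insert g (trans (cong (_xor side g x) (side-opposite-≢ i d)) (xor-same (side g x))) (xor-≢ d)
      (λ h h≢g → cong (_xor side h x) (side-opposite-other i (h≢g ∘ sym)))

  dist-away : ∀ {v g x} (i : Incident T v g) → side g v ≡ side g x → dist (opposite i) x ≡ suc (dist v x)
  dist-away {v} {g} {x} i eq =
    count-insert g (trans (cong (_xor side g x) eq) (xor-same (side g x)))
      (xor-≢ (λ e → not-¬ e (trans (side-opposite i) (cong not eq))))
      (λ h h≢g → cong (_xor side h x) (sym (side-opposite-other i (h≢g ∘ sym))))

  avoidingPath : (S : Fin E → Bool) {u v : Fin V} → (∀ h → S h ≡ true → side h u ≡ side h v) →
                 Path graph (λ h → S h ≡ false) u v
  avoidingPath S {v = v} = go _ refl
    where
    go : ∀ n {u} → dist u v ≡ n → (∀ h → S h ≡ true → side h u ≡ side h v) →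
         Path graph (λ h → S h ≡ false) u v
    go n {u} du same with u ≟ v
    ... | yes refl = here
    ... | no u≢v with next u≢v
    ...   | g , i , d with S g in Sg | n | trans (sym (dist-toward i d)) du
    ...     | true  | _     | _  = ⊥-elim (d (same g Sg))
    ...     | false | suc m | du' = crossₚ i Sg ++ₚ go m (suc-injective du') λ h Sh →
      trans (side-opposite-other i (λ g≡h → true≢false (trans (sym Sh) (trans (cong S (sym g≡h)) Sg)))) (same h Sh)

  record Extremal (x₀ : Fin V) (S : Fin E → Bool) (y : Fin V) : Set where
    constructor extremal
    field
      vertex      : Fin V
      fixes       : ∀ h → S h ≡ false → side h vertex ≡ side h y
      points-back : ∀ g → Incident T vertex g → S g ≡ true → side g vertex ≢ side g x₀

  -- Each step across an S-edge leading away from x₀ increases the distance to x₀, so at most E steps are taken.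
  walkAwayFrom : ∀ m x₀ S y → E ≤ m + dist y x₀ → Extremal x₀ S y
  walkAwayFrom m x₀ S y bound
    with any? (λ g → incident? y g ×-dec ((S g ≟ᵇ true) ×-dec (side g y ≟ᵇ side g x₀)))
  ... | no none = extremal y (λ _ _ → refl) (λ g i Sg eq → none (g , i , Sg , eq))
  ... | yes (g , i , Sg , eq) with m
  ...   | zero = ⊥-elim (n≮n _ (≤-trans (≤-reflexive (sym (dist-away i eq))) (≤-trans (count≤ _) bound)))
  ...   | suc m' with walkAwayFrom m' x₀ S (opposite i)
                       (≤-trans bound (≤-reflexive (trans (sym (+-suc m' _)) (cong (m' +_) (sym (dist-away i eq))))))
  ...     | extremal z fix back = extremal z (λ h Sh → trans (fix h Sh) (side-opposite-other i λ g≡h →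
                                      true≢false (trans (sym Sg) (trans (cong S g≡h) Sh)))) back

  walkAway : ∀ x₀ S → Extremal x₀ S x₀
  walkAway x₀ S = walkAwayFrom E x₀ S x₀ (m≤m+n E _)

  back-edge-unique : ∀ {z x₀ g h} → Incident T z g → Incident T z h →
                     side g z ≢ side g x₀ → side h z ≢ side h x₀ → g ≡ h
  back-edge-unique {g = g} {h} ig ih dg dh with g ≟ h
  ... | yes g≡h = g≡h
  ... | no g≢h  = ⊥-elim (no-four-quadrants g≢h
        (λ e → dg (trans (sym (side-opposite-other ih (g≢h ∘ sym))) e)) (side-opposite-≢ ih dh)
        (side-opposite-≢ ig dg) (λ e → dh (trans (sym (side-opposite-other ig g≢h)) e))
        dg dh)

  extremal-incident : ∀ {x₀ S y c} (r : Extremal x₀ S y) → let z = Extremal.vertex r in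
                      Incident T z c → S c ≡ true → ∀ g → Incident T z g → S g ≡ false ⊎ g ≡ c
  extremal-incident {S = S} r ic Sc g ig with S g in Sg
  ... | false = inj₁ refl
  ... | true  = inj₂ (back-edge-unique ig ic (points-back g ig Sg) (points-back _ ic Sc))
    where open Extremal r

  module _ (S O : Fin E → Bool)
           (pairwise : ∀ e g → S e ≡ true → S g ≡ true → ∃ λ z → side e z ≡ O e × side g z ≡ O g) where

    misoriented : Fin V → ℕ
    misoriented y = count (λ e → S e ∧ (side e y xor O e))

    cross-misoriented : ∀ {y g} (i : Incident T y g) → S g ≡ true → side g y ≢ O g →
                        suc (misoriented (opposite i)) ≡ misoriented y
    cross-misoriented {y} {g} i Sg wrong = sym (count-insert g now-right was-wrong others)
      where
      now-right : S g ∧ (side g (opposite i) xor O g) ≡ false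
      now-right rewrite Sg | trans (side-opposite i) (sym (¬-not (wrong ∘ sym))) = xor-same (O g)
      was-wrong : S g ∧ (side g y xor O g) ≡ true
      was-wrong rewrite Sg = xor-≢ wrong
      others : ∀ h → h ≢ g → S h ∧ (side h (opposite i) xor O h) ≡ S h ∧ (side h y xor O h)
      others h h≢g rewrite side-opposite-other i (h≢g ∘ sym) = refl

    cross-outside : ∀ {y g} (i : Incident T y g) → S g ≡ false → misoriented (opposite i) ≡ misoriented y
    cross-outside {y} {g} i Sg = count-cong others
      where
      others : ∀ h → S h ∧ (side h (opposite i) xor O h) ≡ S h ∧ (side h y xor O h)
      others h with h ≟ g
      ... | yes refl rewrite Sg = refl
      ... | no h≢g rewrite side-opposite-other i (h≢g ∘ sym) = refl

    first-edge-misoriented : ∀ {y e g a} (i : Incident T y g) → S e ≡ true → S g ≡ true →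
                             side e y ≢ O e → side e a ≡ O e → side g y ≢ side g a → side g y ≢ O g
    first-edge-misoriented {y} {e} {g} i Se Sg d ea dg gy with g ≟ e
    ... | yes refl = d gy
    ... | no g≢e with pairwise e g Se Sg
    ...   | z , ez , gz = no-four-quadrants (g≢e ∘ sym)
            (λ eq → d (trans eq ez)) (trans gy (sym gz))
            (trans ea (sym ez)) (λ eq → dg (trans gy (trans (sym gz) (sym eq))))
            (λ eq → d (trans (sym (side-opposite-other i g≢e)) (trans eq ez)))
            (λ eq → not-¬ (trans gz (sym gy)) (trans (sym eq) (side-opposite i)))

    -- Walk from y towards a until an edge of S is crossed; that edge was misoriented at y too.
    reorient : ∀ k y e → S e ≡ true → side e y ≢ O e → (a : Fin V) → side e a ≡ O e → dist y a ≡ k →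
               ∃ λ y' → suc (misoriented y') ≡ misoriented y
    reorient k y e Se d a ea dya with y ≟ a
    ... | yes refl = ⊥-elim (d ea)
    ... | no y≢a with next y≢a
    ...   | g , i , dg with S g in Sg
    ...     | true = opposite i , cross-misoriented i Sg (first-edge-misoriented i Se Sg d ea dg)
    ...     | false with k | trans (sym (dist-toward i dg)) dya
    ...       | suc k' | dya' =
      let (y' , fewer) = reorient k' (opposite i) e Se (d ∘ trans (sym (side-opposite-other i g≢e)))
                                  a ea (suc-injective dya')
      in y' , trans fewer (cross-outside i Sg)
      where
      g≢e : g ≢ e
      g≢e g≡e = true≢false (trans (sym Se) (trans (cong S (sym g≡e)) Sg))

    helly-from : ∀ m y → misoriented y ≡ m → ∃ λ y' → ∀ e → S e ≡ true → side e y' ≡ O e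
    helly-from m y my with any? (λ e → (S e ≟ᵇ true) ×-dec ¬? (side e y ≟ᵇ O e))
    ... | no none = y , λ e Se → decidable-stable (side e y ≟ᵇ O e) (λ wrong → none (e , Se , wrong))
    ... | yes (e , Se , wrong) with endpoint-on e (O e)
    ...   | a , ea with reorient _ y e Se wrong a ea refl | m
    ...     | y' , fewer | zero    = ⊥-elim (0≢1+n (trans (sym my) (sym fewer)))
    ...     | y' , fewer | suc m'  = helly-from m' y' (suc-injective (trans fewer my))

    helly : Fin V → ∃ λ y → ∀ e → S e ≡ true → side e y ≡ O e
    helly y = helly-from _ y refl

module Valence (T : Tree) where
  open Tree T

  valence≡ : ∀ v → valence graph v ≡ count (λ e → does (src e ≟ v)) + count (λ e → does (tgt e ≟ v))
  valence≡ v = cong₂ _+_ (length-filter-tabulate (λ e → src e ≟ v) (λ e → e))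
                         (length-filter-tabulate (λ e → tgt e ≟ v) (λ e → e))

  src≢tgt : ∀ g → src g ≢ tgt g
  src≢tgt g eq = acyclic g (subst (Path graph _ (src g)) eq here)

  1≤valence : ∀ {v g} → Incident T v g → 1 ≤ valence graph v
  1≤valence {g = g} (inj₁ refl) rewrite valence≡ (src g) =
    ≤-trans (count-pos g (dec-true (src g ≟ src g) refl)) (m≤m+n _ _)
  1≤valence {g = g} (inj₂ refl) rewrite valence≡ (tgt g) =
    ≤-trans (count-pos g (dec-true (tgt g ≟ tgt g) refl)) (m≤n+m _ _)

  valence≤2 : ∀ {v} g₁ g₂ → (∀ g → Incident T v g → g ≡ g₁ ⊎ g ≡ g₂) → valence graph v ≤ 2
  valence≤2 {v} g₁ g₂ ⊆ rewrite valence≡ v = begin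
    count (λ e → does (src e ≟ v)) + count (λ e → does (tgt e ≟ v))
      ≡⟨ count-∨-disjoint (λ e → does (src e ≟ v)) (λ e → does (tgt e ≟ v)) no-loop ⟩
    count (λ e → does (src e ≟ v) ∨ does (tgt e ≟ v))
      ≤⟨ count-mono {g = λ e → does (e ≟ g₁) ∨ does (e ≟ g₂)} incident⊆ ⟩
    count (λ e → does (e ≟ g₁) ∨ does (e ≟ g₂))
      ≤⟨ count-∨ (λ e → does (e ≟ g₁)) (λ e → does (e ≟ g₂)) ⟩
    count (λ e → does (e ≟ g₁)) + count (λ e → does (e ≟ g₂))
      ≡⟨ cong₂ _+_ (count-singleton g₁) (count-singleton g₂) ⟩
    2 ∎
    where
    open ≤-Reasoning
    no-loop : ∀ e → does (src e ≟ v) ∧ does (tgt e ≟ v) ≡ false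
    no-loop e with src e ≟ v | tgt e ≟ v
    ... | yes s | yes t = ⊥-elim (src≢tgt e (trans s (sym t)))
    ... | yes _ | no _  = refl
    ... | no _  | _     = refl
    incident⊆ : ∀ e → does (src e ≟ v) ∨ does (tgt e ≟ v) ≡ true → does (e ≟ g₁) ∨ does (e ≟ g₂) ≡ true
    incident⊆ e incident with src e ≟ v | tgt e ≟ v | e ≟ g₁ | e ≟ g₂
    ... | _     | _     | yes _ | _     = refl
    ... | _     | _     | no _  | yes _ = refl
    ... | yes s | _     | no n₁ | no n₂ = ⊥-elim ([ n₁ , n₂ ]′ (⊆ e (inj₁ s)))
    ... | no _  | yes t | no n₁ | no n₂ = ⊥-elim ([ n₁ , n₂ ]′ (⊆ e (inj₂ t)))
    incident⊆ e () | no _ | no _ | no _ | no _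

  valence-1-or-2 : ∀ {v g} → Incident T v g → ∀ g₁ g₂ → (∀ g → Incident T v g → g ≡ g₁ ⊎ g ≡ g₂) →
                   valence graph v ≡ 1 ⊎ valence graph v ≡ 2
  valence-1-or-2 {v} i g₁ g₂ ⊆ = one-or-two (valence graph v) (1≤valence i) (valence≤2 g₁ g₂ ⊆)
    where
    one-or-two : ∀ k → 1 ≤ k → k ≤ 2 → k ≡ 1 ⊎ k ≡ 2
    one-or-two 1 _ _ = inj₁ refl
    one-or-two 2 _ _ = inj₂ refl
    one-or-two (suc (suc (suc k))) _ (s≤s (s≤s ()))

module MarkedTree {k} (Γ : MTree (suc (suc k))) where
  open MTree Γ
  open TreeSides tree
  open Valence tree

  has-incident-edge : ∀ z → ∃ λ g → Incident tree z g
  has-incident-edge z with z ≟ mark fzero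
  ... | no z≢m₀  = let (g , i , _) = next z≢m₀ in g , i
  ... | yes z≡m₀ = let (g , i , _) = next (λ z≡m₁ → 0≢1 (mark-inj (trans (sym z≡m₀) z≡m₁))) in g , i
    where
    0≢1 : fzero ≢ fsuc fzero
    0≢1 ()

  marked-if-low-valence : ∀ z g₁ g₂ → (∀ g → Incident tree z g → g ≡ g₁ ⊎ g ≡ g₂) → ∃ λ i → mark i ≡ z
  marked-if-low-valence z g₁ g₂ ⊆ = low-marked z (valence-1-or-2 (proj₂ (has-incident-edge z)) g₁ g₂ ⊆)

  -- Walking away from z ends at a leaf: the edges outside S all sit at z.
  marked-beyond : ∀ S {z c} → Incident tree z c → S c ≡ true → (∀ g → S g ≡ false → Incident tree z g) →
                  ∃ λ i → ∀ h → S h ≡ false → side h (mark i) ≡ side h z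
  marked-beyond S {z} {c} ic Sc outside-at-z =
    let (i , i-at-leaf) = marked-if-low-valence leaf g₀ g₀ (λ g ig → inj₁ (only-edge g ig))
    in i , λ h Sh → trans (cong (side h) i-at-leaf) (fixes h Sh)
    where
    open Extremal (walkAway z S) renaming (vertex to leaf)
    leaf≢z : leaf ≢ z
    leaf≢z eq = points-back c (subst (λ v → Incident tree v c) (sym eq) ic) Sc (cong (side c) eq)
    all-S : ∀ g → Incident tree leaf g → S g ≡ true
    all-S g ig with S g in Sg
    ... | true  = refl
    ... | false = ⊥-elim (leaf≢z (endpoints-by-side ig (outside-at-z g Sg) (fixes g Sg)))
    g₀ : Fin E
    g₀ = proj₁ (has-incident-edge leaf)
    ig₀ : Incident tree leaf g₀
    ig₀ = proj₂ (has-incident-edge leaf)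
    only-edge : ∀ g → Incident tree leaf g → g ≡ g₀
    only-edge g ig = back-edge-unique ig ig₀ (points-back g ig (all-S g ig)) (points-back g₀ ig₀ (all-S g₀ ig₀))

  -- Walk away from x across S-edges; if the end z has three edges (a, b and a back edge), go on to marked-beyond.
  marked-fixing : ∀ S {a b} → (∀ g → S g ≡ false → g ≡ a ⊎ g ≡ b) →
                  ∀ x → ∃ λ i → ∀ h → S h ≡ false → side h (mark i) ≡ side h x
  marked-fixing S {a} {b} outside x = from-z
    where
    open Extremal (walkAway x S) renaming (vertex to z)

    fixed : ∃ (λ i → mark i ≡ z) → ∃ λ i → ∀ h → S h ≡ false → side h (mark i) ≡ side h x
    fixed (i , i-at-z) = i , λ h Sh → trans (cong (side h) i-at-z) (fixes h Sh)

    from-z : ∃ λ i → ∀ h → S h ≡ false → side h (mark i) ≡ side h x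
    from-z with any? (λ g → incident? z g ×-dec (S g ≟ᵇ true))
    ... | no none = fixed (marked-if-low-valence z a b λ g ig → outside g (¬-not (λ Sg → none (g , ig , Sg))))
    ... | yes (c , ic , Sc) with incident? z a | incident? z b
    ...   | no ¬ia | _ = fixed (marked-if-low-valence z b c λ g ig →
                           [ [ (λ { refl → ⊥-elim (¬ia ig) }) , inj₁ ]′ ∘ outside g , inj₂ ]′
                             (extremal-incident (walkAway x S) ic Sc g ig))
    ...   | yes _ | no ¬ib = fixed (marked-if-low-valence z a c λ g ig →
                           [ [ inj₁ , (λ { refl → ⊥-elim (¬ib ig) }) ]′ ∘ outside g , inj₂ ]′
                             (extremal-incident (walkAway x S) ic Sc g ig))
    ...   | yes ia | yes ib =
      let (i , fix) = marked-beyond S ic Sc λ g Sg → [ (λ { refl → ia }) , (λ { refl → ib }) ]′ (outside g Sg)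
      in i , λ h Sh → trans (fix h Sh) (fixes h Sh)

  marked-in-region : ∀ x a b → ∃ λ i → side a (mark i) ≡ side a x × side b (mark i) ≡ side b x
  marked-in-region x a b = let (i , fix) = marked-fixing S outside x in i , fix a S-a , fix b S-b
    where
    S : Fin E → Bool
    S g = not (does (g ≟ a) ∨ does (g ≟ b))

    outside : ∀ g → S g ≡ false → g ≡ a ⊎ g ≡ b
    outside g Sg with g ≟ a | g ≟ b
    ... | yes g≡a | _       = inj₁ g≡a
    ... | no _    | yes g≡b = inj₂ g≡b

    S-a : S a ≡ false
    S-a rewrite dec-true (a ≟ a) refl = refl

    S-b : S b ≡ false
    S-b rewrite dec-true (b ≟ b) refl with does (b ≟ a)
    ... | true  = refl
    ... | false = refl

  split-injective : ∀ {e g} → SameEdge Γ e Γ g → e ≡ g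
  split-injective {e} {g} same with e ≟ g
  ... | yes e≡g = e≡g
  ... | no e≢g with marked-in-region (src e) e g | marked-in-region (tgt e) e g
  ...   | i , ie , ig | j , je , jg = ⊥-elim (true≢false (begin
    true              ≡⟨ sym (side-src e) ⟩
    side e (src e)    ≡⟨ sym ie ⟩
    side e (mark i)   ≡⟨ avoiding⇒sameSide (Equivalence.from (same i j) g-unseparated) ⟩
    side e (mark j)   ≡⟨ je ⟩
    side e (tgt e)    ≡⟨ side-tgt e ⟩
    false             ∎))
    where
    open ≡-Reasoning
    g-unseparated : SameSide Γ g i j
    g-unseparated = sameSide⇒avoiding (trans ig (trans (side-adjacent e≢g) (sym jg)))

Realised : ∀ {n} (Γ : MTree n) → Fin (MTree.E Γ) → MTree n → Set
Realised Γ e Γ' = ∃ λ e' → SameEdge Γ e Γ' e'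

Refines : ∀ {n} → MTree n → MTree n → Set
Refines Γ Γ' = ∀ e → Realised Γ' e Γ

SameEdge-sym : ∀ {n} {X Y : MTree n} {e e'} → SameEdge X e Y e' → SameEdge Y e' X e
SameEdge-sym same i j = ⇔-sym (same i j)

SameEdge-trans : ∀ {n} {X Y Z : MTree n} {e e' e''} → SameEdge X e Y e' → SameEdge Y e' Z e'' → SameEdge X e Z e''
SameEdge-trans same same' i j = ⇔-trans (same i j) (same' i j)

module ContractionSplits {n} {A B : MTree n} (c : Contraction A B) where
  open Contraction c
  private
    module A = MTree A
    module B = MTree B

  Uncollapsed : Set
  Uncollapsed = Σ (Fin A.E) (λ e → collapsed e ≡ false)

  preimage : Fin B.E → Uncollapsed
  preimage h = proj₁ (proj₂ ψ-bij h)

  ψ-preimage : ∀ h → ψ (preimage h) ≡ h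
  ψ-preimage h = proj₂ (proj₂ ψ-bij h) refl

  ψ-injective : ∀ {e e'} {ne : collapsed e ≡ false} {ne' : collapsed e' ≡ false} → ψ (e , ne) ≡ ψ (e' , ne') → e ≡ e'
  ψ-injective eq = cong proj₁ (proj₁ ψ-bij eq)

  collapsed-ends : ∀ e → collapsed e ≡ true → φ (A.src e) ≡ φ (A.tgt e)
  collapsed-ends e ce = Equivalence.from (φ-fibres _ _) (fwd e ce here)

  private
    stepB : ∀ {Q : Fin B.E → Set} {x y w} h → Q h → (B.src h ≡ x × B.tgt h ≡ y) ⊎ (B.src h ≡ y × B.tgt h ≡ x) →
            Path B.graph Q y w → Path B.graph Q x w
    stepB h q (inj₁ (refl , refl)) p = fwd h q p
    stepB h q (inj₂ (refl , refl)) p = bwd h q p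

  pushₚ : ∀ {P : Fin A.E → Set} {Q : Fin B.E → Set} → (∀ e (ne : collapsed e ≡ false) → P e → Q (ψ (e , ne))) →
          ∀ {u v} → Path A.graph P u v → Path B.graph Q (φ u) (φ v)
  pushₚ P⇒Q here = here
  pushₚ {Q = Q} P⇒Q {v = v} (fwd e a p) with collapsed e in ce
  ... | true  = subst (λ x → Path B.graph Q x (φ v)) (sym (collapsed-ends e ce)) (pushₚ P⇒Q p)
  ... | false = stepB (ψ (e , ce)) (P⇒Q e ce a) (ψ-ends (e , ce)) (pushₚ P⇒Q p)
  pushₚ {Q = Q} P⇒Q {v = v} (bwd e a p) with collapsed e in ce
  ... | true  = subst (λ x → Path B.graph Q x (φ v)) (collapsed-ends e ce) (pushₚ P⇒Q p)
  ... | false = stepB (ψ (e , ce)) (P⇒Q e ce a) (swap (ψ-ends (e , ce))) (pushₚ P⇒Q p)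

  Lifted : (Fin B.E → Set) → Fin A.E → Set
  Lifted Q e = collapsed e ≡ true ⊎ Σ (collapsed e ≡ false) (λ ne → Q (ψ (e , ne)))

  collapsedₚ : ∀ {Q : Fin B.E → Set} {u v} → φ u ≡ φ v → Path A.graph (Lifted Q) u v
  collapsedₚ eq = mapₚ inj₁ (Equivalence.to (φ-fibres _ _) eq)

  private
    liftEdge : ∀ {Q : Fin B.E → Set} h → Q h → ∀ {u x y} → φ u ≡ x →
               (B.src h ≡ x × B.tgt h ≡ y) ⊎ (B.src h ≡ y × B.tgt h ≡ x) →
               ∃ λ u' → φ u' ≡ y × Path A.graph (Lifted Q) u u'
    liftEdge {Q} h q {u} eu ends with preimage h | ψ-preimage h
    ... | e , ne | refl with ψ-ends (e , ne) | ends
    ... | inj₁ (s , t) | inj₁ (sx , ty) =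
      A.tgt e , trans (sym t) ty , collapsedₚ {Q} (trans eu (trans (sym sx) s)) ++ₚ fwd e (inj₂ (ne , q)) here
    ... | inj₁ (s , t) | inj₂ (sy , tx) =
      A.src e , trans (sym s) sy , collapsedₚ {Q} (trans eu (trans (sym tx) t)) ++ₚ bwd e (inj₂ (ne , q)) here
    ... | inj₂ (s , t) | inj₁ (sx , ty) =
      A.src e , trans (sym t) ty , collapsedₚ {Q} (trans eu (trans (sym sx) s)) ++ₚ bwd e (inj₂ (ne , q)) here
    ... | inj₂ (s , t) | inj₂ (sy , tx) =
      A.tgt e , trans (sym s) sy , collapsedₚ {Q} (trans eu (trans (sym tx) t)) ++ₚ fwd e (inj₂ (ne , q)) here

  pullₚ : ∀ {Q : Fin B.E → Set} {x y} → Path B.graph Q x y →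
          ∀ {u v} → φ u ≡ x → φ v ≡ y → Path A.graph (Lifted Q) u v
  pullₚ {Q} here eu ev = collapsedₚ {Q} (trans eu (sym ev))
  pullₚ (fwd h q p) eu ev = let (_ , eu' , p₁) = liftEdge h q eu (inj₁ (refl , refl)) in p₁ ++ₚ pullₚ p eu' ev
  pullₚ (bwd h q p) eu ev = let (_ , eu' , p₁) = liftEdge h q eu (inj₂ (refl , refl)) in p₁ ++ₚ pullₚ p eu' ev

  uncollapsed-sameEdge : ∀ e (ne : collapsed e ≡ false) → SameEdge A e B (ψ (e , ne))
  uncollapsed-sameEdge e ne i j = mk⇔ forth back
    where
    forth : SameSide A e i j → SameSide B (ψ (e , ne)) i j
    forth p = subst₂ (Path B.graph _) (φ-mark i) (φ-mark j) (pushₚ (λ _ _ e'≢e eq → e'≢e (ψ-injective eq)) p)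
    unlift : ∀ {e'} → Lifted (λ h → h ≢ ψ (e , ne)) e' → e' ≢ e
    unlift (inj₁ ce)        refl = true≢false (trans (sym ce) ne)
    unlift (inj₂ (ne' , q)) refl = q (cong (λ p → ψ (e , p)) (Decidable⇒UIP.≡-irrelevant _≟ᵇ_ ne' ne))
    back : SameSide B (ψ (e , ne)) i j → SameSide A e i j
    back p = mapₚ unlift (pullₚ p (φ-mark i) (φ-mark j))

  preimage-sameEdge : ∀ h → SameEdge A (proj₁ (preimage h)) B h
  preimage-sameEdge h = subst (SameEdge A (proj₁ (preimage h)) B) (ψ-preimage h) (uncollapsed-sameEdge _ _)

  uncollapsed⇒realised : ∀ {e} → collapsed e ≡ false → Realised A e B
  uncollapsed⇒realised {e} ne = ψ (e , ne) , uncollapsed-sameEdge e ne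

  refines : Refines A B
  refines h = proj₁ (preimage h) , SameEdge-sym {X = A} {Y = B} (preimage-sameEdge h)

module RefinementContraction {k} (A B : MTree (suc (suc k))) (refinement : Refines A B) where
  private
    module A = MTree A
    module B = MTree B
    module SA = TreeSides A.tree
    module SB = TreeSides B.tree

  ι : Fin B.E → Fin A.E
  ι e = proj₁ (refinement e)

  ι-same : ∀ e → SameEdge B e A (ι e)
  ι-same e = proj₂ (refinement e)

  ι-injective : ∀ {e g} → ι e ≡ ι g → e ≡ g
  ι-injective {e} {g} eq =
    MarkedTree.split-injective B (SameEdge-trans {X = B} {Y = A} {Z = B}
      (subst (SameEdge B e A) eq (ι-same e)) (SameEdge-sym {X = B} {Y = A} (ι-same g)))

  -- τ e records whether the sides of e in B and of ι e in A are named oppositely.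
  τ : Fin B.E → Bool
  τ e = SA.side (ι e) (A.mark fzero) xor SB.side e (B.mark fzero)

  side-mark : ∀ e i → SB.side e (B.mark i) ≡ SA.side (ι e) (A.mark i) xor τ e
  side-mark e i = begin
    b                  ≡⟨ sym (xor-cancelʳ b b₀) ⟩
    (b xor b₀) xor b₀  ≡⟨ cong (_xor b₀) (≡⇔≡⇒xor≡ b≡⇒a≡ a≡⇒b≡) ⟩
    (a xor a₀) xor b₀  ≡⟨ xor-assoc a a₀ b₀ ⟩
    a xor τ e          ∎
    where
    open ≡-Reasoning
    a a₀ b b₀ : Bool
    a  = SA.side (ι e) (A.mark i)
    a₀ = SA.side (ι e) (A.mark fzero)
    b  = SB.side e (B.mark i)
    b₀ = SB.side e (B.mark fzero)
    b≡⇒a≡ : b ≡ b₀ → a ≡ a₀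
    b≡⇒a≡ = SA.avoiding⇒sameSide ∘ Equivalence.to (ι-same e i fzero) ∘ SB.sameSide⇒avoiding
    a≡⇒b≡ : a ≡ a₀ → b ≡ b₀
    a≡⇒b≡ = SB.avoiding⇒sameSide ∘ Equivalence.from (ι-same e i fzero) ∘ SA.sameSide⇒avoiding

  side-markᴬ : ∀ e i → SA.side (ι e) (A.mark i) ≡ SB.side e (B.mark i) xor τ e
  side-markᴬ e i = trans (sym (xor-cancelʳ _ (τ e))) (cong (_xor τ e) (sym (side-mark e i)))

  image? : ∀ f → Dec (∃ λ e → ι e ≡ f)
  image? f = any? (λ e → ι e ≟ f)

  collapsed : Fin A.E → Bool
  collapsed f = not (does (image? f))

  ι-uncollapsed : ∀ e → collapsed (ι e) ≡ false
  ι-uncollapsed e = cong not (dec-true (image? (ι e)) (e , refl))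

  in-image : ∀ f → collapsed f ≡ false → ∃ λ e → ι e ≡ f
  in-image f cf with image? f
  ... | yes p = p

  -- The vertex φ x of B lies on the side of each edge e that corresponds to the side of ι e containing x.
  target : Fin A.V → Fin B.E → Bool
  target x e = SA.side (ι e) x xor τ e

  targets-realisable : ∀ x e g → true ≡ true → true ≡ true →
                       ∃ λ z → SB.side e z ≡ target x e × SB.side g z ≡ target x g
  targets-realisable x e g _ _ with MarkedTree.marked-in-region A x (ι e) (ι g)
  ... | i , ie , ig = B.mark i , trans (side-mark e i) (cong (_xor τ e) ie)
                               , trans (side-mark g i) (cong (_xor τ g) ig)

  abstract
    φ : Fin A.V → Fin B.V
    φ x = proj₁ (SB.helly (const true) (target x) (targets-realisable x) (B.mark fzero))

    side-φ : ∀ x e → SB.side e (φ x) ≡ target x e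
    side-φ x e = proj₂ (SB.helly (const true) (target x) (targets-realisable x) (B.mark fzero)) e refl

  φ-mark : ∀ i → φ (A.mark i) ≡ B.mark i
  φ-mark i = SB.sides-determine-vertex λ e → trans (side-φ (A.mark i) e) (sym (side-mark e i))

  φ-surjective : ∀ y → ∃ λ x → φ x ≡ y
  φ-surjective y = x , SB.sides-determine-vertex λ e → begin
    SB.side e (φ x)                      ≡⟨ side-φ x e ⟩
    SA.side (ι e) x xor τ e              ≡⟨ cong (_xor τ e) (x-side (ι e) (dec-true (image? (ι e)) (e , refl))) ⟩
    wanted (ι e) (image? (ι e)) xor τ e  ≡⟨ cong (_xor τ e) (wanted-ι e (image? (ι e))) ⟩
    (SB.side e y xor τ e) xor τ e        ≡⟨ xor-cancelʳ _ (τ e) ⟩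
    SB.side e y                          ∎
    where
    open ≡-Reasoning
    wanted : ∀ f → Dec (∃ λ e → ι e ≡ f) → Bool
    wanted f (yes (e , _)) = SB.side e y xor τ e
    wanted f (no _)        = false
    wanted-ι : ∀ e (d : Dec (∃ λ e' → ι e' ≡ ι e)) → wanted (ι e) d ≡ SB.side e y xor τ e
    wanted-ι e (yes (e' , eq)) rewrite ι-injective eq = refl
    wanted-ι e (no ∉)          = ⊥-elim (∉ (e , refl))
    realisable : ∀ f g → does (image? f) ≡ true → does (image? g) ≡ true →
                 ∃ λ z → SA.side f z ≡ wanted f (image? f) × SA.side g z ≡ wanted g (image? g)
    realisable f g f∈ g∈ with image? f | image? g
    ... | yes (e , refl) | yes (e' , refl) with MarkedTree.marked-in-region B y e e'
    ...   | i , ie , ie' = A.mark i , trans (side-markᴬ e i) (cong (_xor τ e) ie)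
                                    , trans (side-markᴬ e' i) (cong (_xor τ e') ie')
    preimage : ∃ λ x → ∀ f → does (image? f) ≡ true → SA.side f x ≡ wanted f (image? f)
    preimage = SA.helly (λ f → does (image? f)) (λ f → wanted f (image? f)) realisable (A.mark fzero)
    x : Fin A.V
    x = proj₁ preimage
    x-side : ∀ f → does (image? f) ≡ true → SA.side f x ≡ wanted f (image? f)
    x-side = proj₂ preimage

  φ-fibres : ∀ u v → (φ u ≡ φ v) ⇔ Path A.graph (In collapsed) u v
  φ-fibres u v = mk⇔ to-path from-path
    where
    to-path : φ u ≡ φ v → Path A.graph (In collapsed) u v
    to-path eq = mapₚ (cong not) (SA.avoidingPath (λ f → does (image? f)) λ f f∈ →
                   same-sides f (in-image f (cong not f∈)))
      where
      same-sides : ∀ f → (∃ λ e → ι e ≡ f) → SA.side f u ≡ SA.side f v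
      same-sides f (e , refl) = xor-injectiveʳ (τ e) (trans (sym (side-φ u e)) (trans (cong (SB.side e) eq) (side-φ v e)))
    from-path : Path A.graph (In collapsed) u v → φ u ≡ φ v
    from-path p = SB.sides-determine-vertex λ e →
      trans (side-φ u e) (trans (cong (_xor τ e) (SA.avoiding⇒sameSide (mapₚ (avoids e) p))) (sym (side-φ v e)))
      where
      avoids : ∀ e {f} → collapsed f ≡ true → f ≢ ι e
      avoids e cf refl = true≢false (trans (sym cf) (ι-uncollapsed e))

  Uncollapsed : Set
  Uncollapsed = Σ (Fin A.E) (λ f → collapsed f ≡ false)

  ψ : Uncollapsed → Fin B.E
  ψ (f , cf) = proj₁ (in-image f cf)

  ι-ψ : ∀ p → ι (ψ p) ≡ proj₁ p
  ι-ψ (f , cf) = proj₂ (in-image f cf)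

  ψ-bijective : Bijective _≡_ _≡_ ψ
  ψ-bijective = injective , λ e → (ι e , ι-uncollapsed e) , λ { refl → ι-injective (ι-ψ (ι e , ι-uncollapsed e)) }
    where
    injective : ∀ {p p'} → ψ p ≡ ψ p' → p ≡ p'
    injective {f , cf} {f' , cf'} eq with trans (sym (ι-ψ (f , cf))) (trans (cong ι eq) (ι-ψ (f' , cf')))
    ... | refl = cong (f ,_) (Decidable⇒UIP.≡-irrelevant _≟ᵇ_ cf cf')

  ψ-ends : ∀ (p : Uncollapsed) → let f = proj₁ p in
             (B.src (ψ p) ≡ φ (A.src f) × B.tgt (ψ p) ≡ φ (A.tgt f))
           ⊎ (B.src (ψ p) ≡ φ (A.tgt f) × B.tgt (ψ p) ≡ φ (A.src f))
  ψ-ends p@(f , cf) = SB.only-separator⇒endpoints unseparated separated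
    where
    e = ψ p
    unseparated : ∀ h → h ≢ e → SB.side h (φ (A.src f)) ≡ SB.side h (φ (A.tgt f))
    unseparated h h≢e = trans (side-φ _ h) (trans (cong (_xor τ h) (SA.side-adjacent f≢ιh)) (sym (side-φ _ h)))
      where
      f≢ιh : f ≢ ι h
      f≢ιh f≡ιh = h≢e (ι-injective (trans (sym f≡ιh) (sym (ι-ψ p))))
    separated : SB.side e (φ (A.src f)) ≢ SB.side e (φ (A.tgt f))
    separated eq = true≢false (begin
      true                   ≡⟨ sym (SA.side-src f) ⟩
      SA.side f (A.src f)    ≡⟨ cong (λ g → SA.side g (A.src f)) (sym (ι-ψ p)) ⟩
      SA.side (ι e) (A.src f) ≡⟨ xor-injectiveʳ (τ e) (trans (sym (side-φ _ e)) (trans eq (side-φ _ e))) ⟩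
      SA.side (ι e) (A.tgt f) ≡⟨ cong (λ g → SA.side g (A.tgt f)) (ι-ψ p) ⟩
      SA.side f (A.tgt f)    ≡⟨ SA.side-tgt f ⟩
      false                  ∎)
      where open ≡-Reasoning

  contraction : Contraction A B
  contraction = record
    { collapsed = collapsed
    ; singly    = λ i j p → B.mark-inj (trans (sym (φ-mark i)) (trans (Equivalence.from (φ-fibres _ _) p) (φ-mark j)))
    ; φ         = φ
    ; φ-surj    = φ-surjective
    ; φ-fibres  = φ-fibres
    ; φ-mark    = φ-mark
    ; ψ         = ψ
    ; ψ-bij     = ψ-bijective
    ; ψ-ends    = ψ-ends
    }

contraction⇔refines : ∀ {k} {A B : MTree (suc (suc k))} → Contraction A B ⇔ Refines A B
contraction⇔refines {A = A} {B} = mk⇔ ContractionSplits.refines (RefinementContraction.contraction A B)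

uncollapsed⇔realised : ∀ {k} {A B : MTree (suc (suc k))} (c : Contraction A B) e →
                       F c e ≡ false ⇔ Realised A e B
uncollapsed⇔realised {A = A} {B} c e = mk⇔ uncollapsed⇒realised realised⇒uncollapsed
  where
  open ContractionSplits c
  realised⇒uncollapsed : Realised A e B → F c e ≡ false
  realised⇒uncollapsed (h , same) =
    subst (λ e' → F c e' ≡ false)
      (sym (MarkedTree.split-injective A (SameEdge-trans {X = A} {Y = B} {Z = A} same
             (SameEdge-sym {X = A} {Y = B} (preimage-sameEdge h)))))
      (proj₂ (preimage h))

contraction⇔subforest-below : ∀ {k} {Γ Γ₁ Γ₂ : MTree (suc (suc k))}
                              (c₁ : Contraction Γ₁ Γ) (c₂ : Contraction Γ₂ Γ) →
                              Contraction Γ₁ Γ₂ ⇔ SubforestOf Γ₂ (F c₂) Γ₁ (F c₁)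
contraction⇔subforest-below {Γ = Γ} {Γ₁} {Γ₂} c₁ c₂ = ⇔-trans contraction⇔refines (mk⇔ to from)
  where
  to : Refines Γ₁ Γ₂ → SubforestOf Γ₂ (F c₂) Γ₁ (F c₁)
  to refinement h h∈F₂ = e , ¬-not uncollapsed-absurd , same
    where
    e = proj₁ (refinement h)
    same = proj₂ (refinement h)
    uncollapsed-absurd : F c₁ e ≢ false
    uncollapsed-absurd e∉F₁ =
      let (g , same') = Equivalence.to (uncollapsed⇔realised c₁ e) e∉F₁
      in true≢false (trans (sym h∈F₂)
           (Equivalence.from (uncollapsed⇔realised c₂ h) (g , SameEdge-trans {X = Γ₂} {Y = Γ₁} {Z = Γ} same same')))
  from : SubforestOf Γ₂ (F c₂) Γ₁ (F c₁) → Refines Γ₁ Γ₂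
  from sub h with F c₂ h in eq
  ... | true  = let (e , _ , same) = sub h eq in e , same
  ... | false = let (g , same) = Equivalence.to (uncollapsed⇔realised c₂ h) eq
                    (e , same') = ContractionSplits.refines c₁ g
                in e , SameEdge-trans {X = Γ₂} {Y = Γ} {Z = Γ₁} same same'

contraction⇔subforest-above : ∀ {k} {Γ Γ₁ Γ₂ : MTree (suc (suc k))}
                              (c₁ : Contraction Γ Γ₁) (c₂ : Contraction Γ Γ₂) →
                              Contraction Γ₁ Γ₂ ⇔ (∀ e → F c₁ e ≡ true → F c₂ e ≡ true)
contraction⇔subforest-above {Γ = Γ} {Γ₁} {Γ₂} c₁ c₂ = ⇔-trans contraction⇔refines (mk⇔ to from)
  where
  to : Refines Γ₁ Γ₂ → ∀ e → F c₁ e ≡ true → F c₂ e ≡ true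
  to refinement e e∈F₁ = ¬-not λ e∉F₂ →
    let (h , same) = Equivalence.to (uncollapsed⇔realised c₂ e) e∉F₂
        (f , same') = refinement h
    in true≢false (trans (sym e∈F₁)
         (Equivalence.from (uncollapsed⇔realised c₁ e) (f , SameEdge-trans {X = Γ} {Y = Γ₂} {Z = Γ₁} same same')))
  from : (∀ e → F c₁ e ≡ true → F c₂ e ≡ true) → Refines Γ₁ Γ₂
  from F₁⊆F₂ h =
    let (e , same) = ContractionSplits.refines c₂ h
        e∉F₂ = Equivalence.from (uncollapsed⇔realised c₂ e) (h , SameEdge-sym {X = Γ₂} {Y = Γ} same)
        e∉F₁ = ¬-not λ e∈F₁ → true≢false (trans (sym (F₁⊆F₂ e e∈F₁)) e∉F₂)
        (f , same') = Equivalence.to (uncollapsed⇔realised c₁ e) e∉F₁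
    in f , SameEdge-trans {X = Γ₂} {Y = Γ} {Z = Γ₁} same same'

corollary2p6 : ∀ {n : ℕ} → 3 ≤ n → (Γ Γ₁ Γ₂ : MTree n) →
    ((c₁ : Contraction Γ₁ Γ) (c₂ : Contraction Γ₂ Γ) →
      Contraction Γ₁ Γ₂ ⇔ SubforestOf Γ₂ (F c₂) Γ₁ (F c₁))
  × ((c₁ : Contraction Γ Γ₁) (c₂ : Contraction Γ Γ₂) →
      Contraction Γ₁ Γ₂ ⇔ (∀ (e : Fin (MTree.E Γ)) → F c₁ e ≡ true → F c₂ e ≡ true))
corollary2p6 (s≤s (s≤s (s≤s _))) Γ Γ₁ Γ₂ = contraction⇔subforest-below , contraction⇔subforest-above
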